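{- Let $\mathbb{T}=(\Sigma,\mathcal{E})$ be a graded theory, $X$ a poset and $n\le\omega$. For every operation $\sigma$ and every $k$ with $k+d(\sigma)\le n$, the map $\sigma^{FX}_k\colon\mathsf{Pos}(\mathrm{ar}(\sigma),(FX)_k)\to(FX)_{k+d(\sigma)}$, $f\mapsto[\sigma(u_k\cdot f)]_{k+d(\sigma)}$, is independent of the choice of the splitting $u_k$ and is monotone.
   Context: Graded signature $\Sigma$: sets $\Sigma(P,n)$ of operation symbols for finite posets $P$, $n\in\omega$; $\mathrm{ar}(\sigma)=P$, $d(\sigma)=n$. $\mathsf{Pos}(P,A)$: monotone maps ordered pointwise. Terms $\mathsf{T}_{\Sigma,k}(\Gamma)$ over a poset $\Gamma$: variables $x\in\Gamma$ of depth $0$; $\sigma(f)$ of depth $d(\sigma)+m$ for $f\colon|\mathrm{ar}(\sigma)|\to\mathsf{T}_{\Sigma,m}(\Gamma)$. Subterms $\mathsf{sub}$ as usual ($\mathsf{sub}(\sigma(f))=\{\sigma(f)\}\cup\bigcup_i\mathsf{sub}(f(i))$). Inequations $\Gamma\vdash_k s\le t$ ($s,t\in\mathsf{T}_{\Sigma,k}(\Gamma)$), ${\downarrow}t$ abbreviating $t\le t$; a graded theory $\mathbb{T}=(\Sigma,\mathcal{E})$ has axioms $\mathcal{E}$. Uniform substitutions $\gamma\colon|\Delta|\to\mathsf{T}_{\Sigma,k}(\Gamma)$ extend to $\bar\gamma$ by $\bar\gamma(\sigma(f))=\sigma(\bar\gamma\cdot f)$. Derivability rules: (Var) $\Gamma\vdash_0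 x\le y$ for $x\le y$ in $\Gamma$. (Ar) from $\Gamma\vdash_k f(i)\le f(j)$ for all $i\le j$ in $\mathrm{ar}(\sigma)$ infer $\Gamma\vdash_{k+d(\sigma)}{\downarrow}\sigma(f)$. (Trans) transitivity. (Mon) from $\Gamma\vdash_k f(i)\le g(i)$ for all $i$ and $\Gamma\vdash_{k+d(\sigma)}{\downarrow}\sigma(f)$, $\Gamma\vdash_{k+d(\sigma)}{\downarrow}\sigma(g)$ infer $\Gamma\vdash_{k+d(\sigma)}\sigma(f)\le\sigma(g)$. (Ax1) for an axiom $\Delta\vdash_n s\le t$ and $\gamma\colon|\Delta|\to\mathsf{T}_{\Sigma,k}(\Gamma)$ with $\Gamma\vdash_k\gamma(x)\le\gamma(y)$ for all $x\le y$ in $\Delta$, infer $\Gamma\vdash_{n+k}\bar\gamma(s)\le\bar\gamma(t)$. (Ax2) same premises, for a subterm $\sigma(f)\in\mathsf{sub}(s,t)$ with $f\colon|\mathrm{ar}(\sigma)|\to\mathsf{T}_{\Sigma,m}(\Delta)$ and $i\le j$ in $\mathrm{ar}(\sigma)$, infer $\Gamma\vdash_{m+k}\bar\gamma(f(i))\le\bar\gamma(f(j))$. Free model construction: $\mathscr{T}_{\mathbb{T},k}(X)$ is the set of $t\in\mathsf{T}_{\Sigma,k}(X)$ with $X\vdash_k{\downarrow}t$ derivable, preordered by $s\le t$ iff $X\vdash_k s\le t$ is derivable; $s\sim t$ iff both $X\vdash_k s\le t$ and $X\vdash_k t\le s$ are derivable. $(FX)_k=\mathscr{T}_{\mathbb{T},k}(X)/\!\sim$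 with the induced partial order and classes $[t]_k$; $q_k\colon\mathscr{T}_{\mathbb{T},k}(X)\to(FX)_k$ is the quotient map and $u_k\colon(FX)_k\to\mathscr{T}_{\mathbb{T},k}(X)$ any map with $q_k\cdot u_k=\mathrm{id}$. -}

module Defs where

open import Data.Nat using (ℕ; _+_) renaming (_≤_ to _≤ℕ_)
open import Data.Nat.Properties using (+-assoc; +-comm)
open import Data.Fin using (Fin)
open import Data.Product using (Σ; _×_; _,_; proj₁; proj₂)
open import Data.Sum using (_⊎_)
open import Data.Unit using (⊤)
open import Relation.Binary.PropositionalEquality
  using (_≡_; subst; sym; trans; cong)
open import Relation.Binary.Structures using (IsPartialOrder)

record PosetS : Set₁ where
  field
    Carrier : Set
    _≤_ : Carrier → Carrier → Set
    isPartialOrder : IsPartialOrder _≡_ _≤_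

record FinPoset : Set₁ where
  field
    size : ℕ
    _≤_ : Fin size → Fin size → Set
    isPartialOrder : IsPartialOrder _≡_ _≤_

-- Graded signatures: the disjoint union of all Σ(P,n) is Op,
-- with ar σ = P and d σ = n.

record GradedSignature : Set₁ where
  field
    Op : Set
    ar : Op → FinPoset
    d  : Op → ℕ

  ∣ar∣ : Op → Set
  ∣ar∣ σ = Fin (FinPoset.size (ar σ))

  _≤[_]_ : ∀ {σ} → ∣ar∣ σ → (σ' : Op) → ∣ar∣ σ → Set
  _≤[_]_ {σ} i σ' j = FinPoset._≤_ (ar σ) i j

module _ (S : GradedSignature) where
  open GradedSignature S

  data Term (Γ : Set) : ℕ → Set where
    var : Γ → Term Γ 0
    op  : ∀ {m} (σ : Op) → (∣ar∣ σ → Term Γ m) → Term Γ (m + d σ)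

  data _⊑_ {Γ : Set} : ∀ {m n} → Term Γ m → Term Γ n → Set where
    here  : ∀ {m} {t : Term Γ m} → t ⊑ t
    there : ∀ {m n} {t : Term Γ m} {σ : Op} {f : ∣ar∣ σ → Term Γ n}
            (i : ∣ar∣ σ) → t ⊑ f i → t ⊑ op σ f

depthEq : (m d k : ℕ) → (m + k) + d ≡ (m + d) + k
depthEq m d k =
  trans (+-assoc m k d) (trans (cong (m +_) (+-comm k d)) (sym (+-assoc m d k)))

bind : (S : GradedSignature) {Δ Γ : Set} {k n : ℕ} →
       (Δ → Term S Γ k) → Term S Δ n → Term S Γ (n + k)
bind S γ (var x) = γ x
bind S {Γ = Γ} {k = k} γ (op {m} σ f) =
  subst (Term S Γ) (depthEq m (GradedSignature.d S σ) k)
        (op σ (λ i → bind S γ (f i)))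

record GradedTheory (S : GradedSignature) : Set₁ where
  field
    Ax    : Set
    ctx   : Ax → PosetS
    depth : Ax → ℕ
    lhs   : (a : Ax) → Term S (PosetS.Carrier (ctx a)) (depth a)
    rhs   : (a : Ax) → Term S (PosetS.Carrier (ctx a)) (depth a)

module _ (S : GradedSignature) (T : GradedTheory S) (Γ : PosetS) where
  open GradedSignature S
  open GradedTheory T
  private
    ∣Γ∣ = PosetS.Carrier Γ

  data Der : (k : ℕ) → Term S ∣Γ∣ k → Term S ∣Γ∣ k → Set where
    Var   : ∀ {x y} → PosetS._≤_ Γ x y → Der 0 (var x) (var y)
    Ar    : ∀ {k σ} {f : ∣ar∣ σ → Term S ∣Γ∣ k} →
            (∀ i j → i ≤[ σ ] j → Der k (f i) (f j)) →
            Der (k + d σ) (op σ f) (op σ f)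
    Trans : ∀ {k s t r} → Der k s t → Der k t r → Der k s r
    Mon   : ∀ {k σ} {f g : ∣ar∣ σ → Term S ∣Γ∣ k} →
            (∀ i → Der k (f i) (g i)) →
            Der (k + d σ) (op σ f) (op σ f) →
            Der (k + d σ) (op σ g) (op σ g) →
            Der (k + d σ) (op σ f) (op σ g)
    Ax1   : ∀ (a : Ax) {k} (γ : PosetS.Carrier (ctx a) → Term S ∣Γ∣ k) →
            (∀ x y → PosetS._≤_ (ctx a) x y → Der k (γ x) (γ y)) →
            Der (depth a + k) (bind S γ (lhs a)) (bind S γ (rhs a))
    Ax2   : ∀ (a : Ax) {k} (γ : PosetS.Carrier (ctx a) → Term S ∣Γ∣ k) →
            (∀ x y → PosetS._≤_ (ctx a) x y → Der k (γ x) (γ y)) →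
            ∀ {m σ} {f : ∣ar∣ σ → Term S (PosetS.Carrier (ctx a)) m} →
            (_⊑_ S (op σ f) (lhs a) ⊎ _⊑_ S (op σ f) (rhs a)) →
            ∀ i j → i ≤[ σ ] j →
            Der (m + k) (bind S γ (f i)) (bind S γ (f j))

-- Free model (setoid presentation of the quotient (FX)_k)

module _ (S : GradedSignature) (T : GradedTheory S) (X : PosetS) where
  open GradedSignature S
  private
    ∣X∣ = PosetS.Carrier X

  𝒯 : ℕ → Set
  𝒯 k = Σ (Term S ∣X∣ k) (λ t → Der S T X k t t)

  _≲_ : ∀ {k} → 𝒯 k → 𝒯 k → Set
  _≲_ {k} s t = Der S T X k (proj₁ s) (proj₁ t)

  -- s ∼ t  (equality of classes [s]_k = [t]_k in (FX)_k)
  _∼_ : ∀ {k} → 𝒯 k → 𝒯 k → Set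
  s ∼ t = (s ≲ t) × (t ≲ s)

  -- a splitting u_k of q_k : a map on the quotient (constant on classes,
  -- as a map into the set of terms) with q_k · u_k = id
  record Splitting (k : ℕ) : Set where
    field
      u        : 𝒯 k → 𝒯 k
      resp     : ∀ a b → a ∼ b → proj₁ (u a) ≡ proj₁ (u b)
      section  : ∀ a → u a ∼ a

  -- elements of Pos(ar σ, (FX)_k), represented by monotone maps into 𝒯_k
  record Mono (σ : Op) (k : ℕ) : Set where
    field
      fun  : ∣ar∣ σ → 𝒯 k
      mono : ∀ i j → i ≤[ σ ] j → fun i ≲ fun j

  _≤ₚ_ : ∀ {σ k} → Mono σ k → Mono σ k → Set
  f ≤ₚ g = ∀ i → Mono.fun f i ≲ Mono.fun g i

  σFX : (σ : Op) {k : ℕ} → Splitting k → Mono σ k → Term S ∣X∣ (k + d σ)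
  σFX σ u f = op σ (λ i → proj₁ (Splitting.u u (Mono.fun f i)))

data ℕω : Set where
  fin : ℕ → ℕω
  ω   : ℕω

_≤ω_ : ℕ → ℕω → Set
k ≤ω fin n = k ≤ℕ n
k ≤ω ω     = ⊤

{-# OPTIONS --safe #-}
module Submission where

-- A splitting returns a representative equivalent to its argument, so a ≲ b
-- gives u a ≲ v b for any two splittings u, v.  Applied pointwise to a monotone
-- f this makes u · f monotone, so (Ar) shows σ(u · f) is defined, and (Mon)
-- compares σ(u · f) with σ(v · g) whenever f ≤ g; independence of the splitting
-- is the case g = f, monotonicity the case v = u.

open import Defs
open import Data.Nat using (ℕ; _+_)
open import Data.Product using (_×_; _,_; proj₁; proj₂)

module _ (S : GradedSignature) (T : GradedTheory S) (X : PosetS) where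
  open GradedSignature S

  splitting-mono : ∀ {k} (u v : Splitting S T X k) {a b : 𝒯 S T X k} →
                   _≲_ S T X a b →
                   _≲_ S T X (Splitting.u u a) (Splitting.u v b)
  splitting-mono u v {a} {b} a≲b =
    Trans (proj₁ (Splitting.section u a)) (Trans a≲b (proj₂ (Splitting.section v b)))

  ≤ₚ-refl : ∀ {σ k} (f : Mono S T X σ k) → _≤ₚ_ S T X f f
  ≤ₚ-refl f i = proj₂ (Mono.fun f i)

  σFX-defined : ∀ σ {k} (u : Splitting S T X k) (f : Mono S T X σ k) →
                Der S T X (k + d σ) (σFX S T X σ u f) (σFX S T X σ u f)
  σFX-defined σ u f = Ar (λ i j i≤j → splitting-mono u u (Mono.mono f i j i≤j))

  σFX-mono : ∀ σ {k} (u v : Splitting S T X k) (f g : Mono S T X σ k) →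
             _≤ₚ_ S T X f g →
             Der S T X (k + d σ) (σFX S T X σ u f) (σFX S T X σ v g)
  σFX-mono σ u v f g f≤g =
    Mon (λ i → splitting-mono u v (f≤g i)) (σFX-defined σ u f) (σFX-defined σ v g)

mainTheorem8 :
    (S : GradedSignature) (T : GradedTheory S) (X : PosetS) (n : ℕω)
    (σ : GradedSignature.Op S) (k : ℕ) →
    (k + GradedSignature.d S σ) ≤ω n →
    -- σ(u_k · f) lies in 𝒯_{k+d(σ)}(X), so [σ(u_k · f)] is defined
    ((u : Splitting S T X k) (f : Mono S T X σ k) →
       Der S T X (k + GradedSignature.d S σ) (σFX S T X σ u f) (σFX S T X σ u f))
    -- independence of the splitting
    × ((u u′ : Splitting S T X k) (f : Mono S T X σ k) →
       Der S T X (k + GradedSignature.d S σ) (σFX S T X σ u f) (σFX S T X σ u′ f)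
       × Der S T X (k + GradedSignature.d S σ) (σFX S T X σ u′ f) (σFX S T X σ u f))
    -- monotonicity
    × ((u : Splitting S T X k) (f g : Mono S T X σ k) → _≤ₚ_ S T X f g →
       Der S T X (k + GradedSignature.d S σ) (σFX S T X σ u f) (σFX S T X σ u g))
mainTheorem8 S T X _ σ _ _ =
  σFX-defined S T X σ ,
  (λ u u′ f → σFX-mono S T X σ u u′ f f (≤ₚ-refl S T X f)
            , σFX-mono S T X σ u′ u f f (≤ₚ-refl S T X f)) ,
  (λ u → σFX-mono S T X σ u u)
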